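{- Let $\langle\mathbf{A},\forall,\exists\rangle$ be an Epistemic BL-algebra whose BL-reduct $\mathbf{A}$ is a Boolean algebra, and let $F$ be a filter of $\mathbf{A}$. Then $F$ is an epistemic BL-filter if and only if $F$ is a $\forall$-filter.
   Context: A BL-algebra is an algebra $\langle A,\wedge,\vee,\ast,\to,0,1\rangle$ such that $\langle A,\wedge,\vee,0,1\rangle$ is a bounded lattice, $\langle A,\ast,1\rangle$ is a commutative monoid, $a\ast b\le c$ iff $a\le b\to c$, and $a\wedge b=a\ast(a\to b)$ and $(a\to b)\vee(b\to a)=1$ hold; a Boolean algebra is regarded as a BL-algebra with $\ast=\wedge$ and $a\to b=\neg a\vee b$. An Epistemic BL-algebra is a BL-algebra with unary operations $\forall,\exists$ satisfying, for all $a,b$: $\forall 1=1$; $\exists 0=0$; $\forall a\to\exists a=1$; $\forall(a\to\forall b)=\exists a\to\forall b$; $\forall(\forall a\to b)=\forall a\to\forall b$; $\exists a\to\forall\exists a=1$; $\forall(a\wedge b)=\forall a\wedge\forall b$; $\exists(a\vee b)=\exists a\vee\exists b$; $\exists(a\ast\exists b)=\exists a\ast\exists b$. A filter (implicative filter) is a subset $F$ with $1\in F$ such that $x\in F$ and $x\to y\in F$ imply $y\in F$. An epistemic BL-filter is a filter $F$ such that $a\to b\in F$ implies $\forall a\to\forall b\in F$ and $\exists a\to\exists b\in F$. A $\forall$-filter is a filter $F$ such that $a\in F$ implies $\forall a\in F$. -}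

module Defs where

open import Level using (Level; suc; _⊔_)
open import Relation.Binary.PropositionalEquality using (_≡_)
open import Data.Product using (_×_; Σ)
open import Algebra.Core using (Op₁; Op₂)
open import Algebra.Lattice.Structures using (IsLattice; IsBooleanAlgebra)
open import Algebra.Structures using (IsCommutativeMonoid)

record BLAlgebra (a : Level) : Set (suc a) where
  infixr 6 _∨_
  infixr 7 _∧_
  infixr 7 _∗_
  infixr 5 _⇒_
  field
    Carrier : Set a
    _∧_ _∨_ _∗_ _⇒_ : Op₂ Carrier
    𝟘 𝟙 : Carrier

  _≤_ : Carrier → Carrier → Set a
  x ≤ y = x ∧ y ≡ x

  field
    isLattice : IsLattice _≡_ _∨_ _∧_
    bottom : ∀ x → 𝟘 ≤ x
    top : ∀ x → x ≤ 𝟙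
    ∗-isCommutativeMonoid : IsCommutativeMonoid _≡_ _∗_ 𝟙
    residuation₁ : ∀ x y z → (x ∗ y) ≤ z → x ≤ (y ⇒ z)
    residuation₂ : ∀ x y z → x ≤ (y ⇒ z) → (x ∗ y) ≤ z
    divisibility : ∀ x y → x ∧ y ≡ x ∗ (x ⇒ y)
    prelinearity : ∀ x y → (x ⇒ y) ∨ (y ⇒ x) ≡ 𝟙

IsBooleanBL : ∀ {a} → BLAlgebra a → Set a
IsBooleanBL B = Σ (Op₁ Carrier) λ ¬ →
    IsBooleanAlgebra _≡_ _∨_ _∧_ ¬ 𝟙 𝟘
  × (∀ x y → x ∗ y ≡ x ∧ y)
  × (∀ x y → (x ⇒ y) ≡ ¬ x ∨ y)
  where open BLAlgebra B

record EpistemicBL (a : Level) : Set (suc a) where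
  field
    bl : BLAlgebra a
  open BLAlgebra bl public
  field
    𝔸 𝔼 : Op₁ Carrier
    ax1 : 𝔸 𝟙 ≡ 𝟙
    ax2 : 𝔼 𝟘 ≡ 𝟘
    ax3 : ∀ x → (𝔸 x ⇒ 𝔼 x) ≡ 𝟙
    ax4 : ∀ x y → 𝔸 (x ⇒ 𝔸 y) ≡ (𝔼 x ⇒ 𝔸 y)
    ax5 : ∀ x y → 𝔸 (𝔸 x ⇒ y) ≡ (𝔸 x ⇒ 𝔸 y)
    ax6 : ∀ x → (𝔼 x ⇒ 𝔸 (𝔼 x)) ≡ 𝟙
    ax7 : ∀ x y → 𝔸 (x ∧ y) ≡ 𝔸 x ∧ 𝔸 y
    ax8 : ∀ x y → 𝔼 (x ∨ y) ≡ 𝔼 x ∨ 𝔼 y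
    ax9 : ∀ x y → 𝔼 (x ∗ 𝔼 y) ≡ 𝔼 x ∗ 𝔼 y

module _ {a : Level} (E : EpistemicBL a) where
  open EpistemicBL E

  IsFilter : (Carrier → Set a) → Set a
  IsFilter F = F 𝟙 × (∀ x y → F x → F (x ⇒ y) → F y)

  IsEpistemicFilter : (Carrier → Set a) → Set a
  IsEpistemicFilter F = IsFilter F
    × (∀ x y → F (x ⇒ y) → F (𝔸 x ⇒ 𝔸 y) × F (𝔼 x ⇒ 𝔼 y))

  Is∀Filter : (Carrier → Set a) → Set a
  Is∀Filter F = IsFilter F × (∀ x → F x → F (𝔸 x))

-- A ∀-filter is closed under the epistemic rules because 𝔸 (x ⇒ y) ≤ 𝔸 x ⇒ 𝔸 y,
-- which in a Boolean algebra follows from ∗ = ∧ and 𝔸 preserving meets.  The rule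
-- for 𝔼 is its dual: 𝔸 (¬ x) = ¬ (𝔼 x) since 𝔸 𝟘 = 𝟘, so contraposition turns
-- x ⇒ y into ¬ y ⇒ ¬ x and 𝔸 ¬ y ⇒ 𝔸 ¬ x back into 𝔼 x ⇒ 𝔼 y.  Conversely, the
-- epistemic rule applied to 𝟙 ⇒ x = x gives 𝔸 𝟙 ⇒ 𝔸 x = 𝔸 x, in any epistemic BL-algebra.
module Submission where

open import Defs
open import Level using (Level)
open import Function.Bundles using (_⇔_; mk⇔)
open import Data.Product using (_,_; proj₁; proj₂)
open import Relation.Binary.PropositionalEquality
open import Algebra.Lattice.Bundles using (Lattice; BooleanAlgebra)
import Algebra.Lattice.Properties.Lattice as LatticeProperties
import Algebra.Lattice.Properties.BooleanAlgebra as BooleanAlgebraProperties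
open import Algebra.Lattice.Structures using (IsLattice; IsBooleanAlgebra)
open import Algebra.Structures using (IsCommutativeMonoid)

module BLProperties {a : Level} (A : BLAlgebra a) where
  open BLAlgebra A
  open IsLattice isLattice using (∧-comm)
  open IsCommutativeMonoid ∗-isCommutativeMonoid using (identityˡ)

  lattice : Lattice a a
  lattice = record { isLattice = isLattice }

  open LatticeProperties lattice using (∧-idem)
  open ≡-Reasoning

  ≤-antisym : ∀ {x y} → x ≤ y → y ≤ x → x ≡ y
  ≤-antisym {x} {y} x≤y y≤x = trans (sym x≤y) (trans (∧-comm x y) y≤x)

  𝟙⇒-identity : ∀ x → (𝟙 ⇒ x) ≡ x
  𝟙⇒-identity x = begin
    𝟙 ⇒ x           ≡⟨ identityˡ (𝟙 ⇒ x) ⟨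
    𝟙 ∗ (𝟙 ⇒ x)     ≡⟨ divisibility 𝟙 x ⟨
    𝟙 ∧ x           ≡⟨ ∧-comm 𝟙 x ⟩
    x ∧ 𝟙           ≡⟨ top x ⟩
    x               ∎

  ⇒-∗-≤ : ∀ x y → ((x ⇒ y) ∗ x) ≤ y
  ⇒-∗-≤ x y = residuation₂ (x ⇒ y) x y (∧-idem (x ⇒ y))

  ≤⇒⇒≡𝟙 : ∀ {x y} → x ≤ y → (x ⇒ y) ≡ 𝟙
  ≤⇒⇒≡𝟙 {x} {y} x≤y =
    ≤-antisym (top (x ⇒ y))
      (residuation₁ 𝟙 x y (subst (λ t → t ≤ y) (sym (identityˡ x)) x≤y))

  ⇒≡𝟙⇒≤ : ∀ {x y} → (x ⇒ y) ≡ 𝟙 → x ≤ y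
  ⇒≡𝟙⇒≤ {x} {y} x⇒y≡𝟙 =
    subst (λ t → t ≤ y) (identityˡ x)
      (residuation₂ 𝟙 x y (subst (𝟙 ≤_) (sym x⇒y≡𝟙) (top 𝟙)))

module EpistemicProperties {a : Level} (E : EpistemicBL a) where
  open EpistemicBL E
  open BLProperties bl public

  filter-upward : ∀ {F} → IsFilter E F → ∀ {x y} → x ≤ y → F x → F y
  filter-upward {F} (F𝟙 , mp) {x} {y} x≤y Fx =
    mp x y Fx (subst F (sym (≤⇒⇒≡𝟙 x≤y)) F𝟙)

  𝔸-mono : ∀ {x y} → x ≤ y → 𝔸 x ≤ 𝔸 y
  𝔸-mono {x} {y} x≤y = trans (sym (ax7 x y)) (cong 𝔸 x≤y)

  𝔸𝟘≡𝟘 : 𝔸 𝟘 ≡ 𝟘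
  𝔸𝟘≡𝟘 = ≤-antisym (subst (𝔸 𝟘 ≤_) ax2 (⇒≡𝟙⇒≤ (ax3 𝟘))) (bottom (𝔸 𝟘))

  𝔸-⇒𝟘 : ∀ x → 𝔸 (x ⇒ 𝟘) ≡ (𝔼 x ⇒ 𝟘)
  𝔸-⇒𝟘 x = begin
    𝔸 (x ⇒ 𝟘)       ≡⟨ cong (λ t → 𝔸 (x ⇒ t)) 𝔸𝟘≡𝟘 ⟨
    𝔸 (x ⇒ 𝔸 𝟘)     ≡⟨ ax4 x 𝟘 ⟩
    𝔼 x ⇒ 𝔸 𝟘       ≡⟨ cong (𝔼 x ⇒_) 𝔸𝟘≡𝟘 ⟩
    𝔼 x ⇒ 𝟘         ∎
    where open ≡-Reasoning

  epistemicFilter⇒∀Filter : ∀ {F} → IsEpistemicFilter E F → Is∀Filter E F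
  epistemicFilter⇒∀Filter {F} (isFilter , rules) = isFilter , F𝔸
    where
    F𝔸 : ∀ x → F x → F (𝔸 x)
    F𝔸 x Fx = subst F (trans (cong (_⇒ 𝔸 x) ax1) (𝟙⇒-identity (𝔸 x)))
      (proj₁ (rules 𝟙 x (subst F (sym (𝟙⇒-identity x)) Fx)))

module BooleanEpistemicProperties {a : Level} (E : EpistemicBL a)
                                  (boolean : IsBooleanBL (EpistemicBL.bl E)) where
  open EpistemicBL E
  open EpistemicProperties E
  open ≡-Reasoning

  ¬ : Carrier → Carrier
  ¬ = proj₁ boolean

  isBooleanAlgebra : IsBooleanAlgebra _≡_ _∨_ _∧_ ¬ 𝟙 𝟘
  isBooleanAlgebra = proj₁ (proj₂ boolean)

  ∗≡∧ : ∀ x y → x ∗ y ≡ x ∧ y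
  ∗≡∧ = proj₁ (proj₂ (proj₂ boolean))

  ⇒≡¬∨ : ∀ x y → (x ⇒ y) ≡ ¬ x ∨ y
  ⇒≡¬∨ = proj₂ (proj₂ (proj₂ boolean))

  booleanAlgebra : BooleanAlgebra a a
  booleanAlgebra = record { isBooleanAlgebra = isBooleanAlgebra }

  open BooleanAlgebraProperties booleanAlgebra using (∨-identityʳ; ¬-involutive)
  open IsBooleanAlgebra isBooleanAlgebra using (∨-comm)

  ⇒𝟘≡¬ : ∀ x → (x ⇒ 𝟘) ≡ ¬ x
  ⇒𝟘≡¬ x = trans (⇒≡¬∨ x 𝟘) (∨-identityʳ (¬ x))

  𝔸¬≡¬𝔼 : ∀ x → 𝔸 (¬ x) ≡ ¬ (𝔼 x)
  𝔸¬≡¬𝔼 x = begin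
    𝔸 (¬ x)         ≡⟨ cong 𝔸 (⇒𝟘≡¬ x) ⟨
    𝔸 (x ⇒ 𝟘)       ≡⟨ 𝔸-⇒𝟘 x ⟩
    𝔼 x ⇒ 𝟘         ≡⟨ ⇒𝟘≡¬ (𝔼 x) ⟩
    ¬ (𝔼 x)         ∎

  contraposition : ∀ x y → (¬ y ⇒ ¬ x) ≡ (x ⇒ y)
  contraposition x y = begin
    ¬ y ⇒ ¬ x       ≡⟨ ⇒≡¬∨ (¬ y) (¬ x) ⟩
    ¬ (¬ y) ∨ ¬ x   ≡⟨ cong (_∨ ¬ x) (¬-involutive y) ⟩
    y ∨ ¬ x         ≡⟨ ∨-comm y (¬ x) ⟩
    ¬ x ∨ y         ≡⟨ ⇒≡¬∨ x y ⟨
    x ⇒ y           ∎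

  𝔸-∗ : ∀ x y → 𝔸 (x ∗ y) ≡ 𝔸 x ∗ 𝔸 y
  𝔸-∗ x y = begin
    𝔸 (x ∗ y)       ≡⟨ cong 𝔸 (∗≡∧ x y) ⟩
    𝔸 (x ∧ y)       ≡⟨ ax7 x y ⟩
    𝔸 x ∧ 𝔸 y       ≡⟨ ∗≡∧ (𝔸 x) (𝔸 y) ⟨
    𝔸 x ∗ 𝔸 y       ∎

  𝔸-⇒-≤ : ∀ x y → 𝔸 (x ⇒ y) ≤ (𝔸 x ⇒ 𝔸 y)
  𝔸-⇒-≤ x y = residuation₁ (𝔸 (x ⇒ y)) (𝔸 x) (𝔸 y)
    (subst (λ t → t ≤ 𝔸 y) (𝔸-∗ (x ⇒ y) x) (𝔸-mono (⇒-∗-≤ x y)))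

  ∀Filter⇒epistemicFilter : ∀ {F} → Is∀Filter E F → IsEpistemicFilter E F
  ∀Filter⇒epistemicFilter {F} (isFilter , F𝔸) = isFilter , λ x y F⇒ → F𝔸⇒ x y F⇒ , F𝔼⇒ x y F⇒
    where
    F𝔸⇒ : ∀ x y → F (x ⇒ y) → F (𝔸 x ⇒ 𝔸 y)
    F𝔸⇒ x y F⇒ = filter-upward isFilter (𝔸-⇒-≤ x y) (F𝔸 (x ⇒ y) F⇒)

    F𝔼⇒ : ∀ x y → F (x ⇒ y) → F (𝔼 x ⇒ 𝔼 y)
    F𝔼⇒ x y F⇒ =
      subst F (trans (cong₂ _⇒_ (𝔸¬≡¬𝔼 y) (𝔸¬≡¬𝔼 x)) (contraposition (𝔼 x) (𝔼 y)))
        (F𝔸⇒ (¬ y) (¬ x) (subst F (sym (contraposition x y)) F⇒))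

theorem4 : {a : Level} (E : EpistemicBL a) → IsBooleanBL (EpistemicBL.bl E) →
    (F : EpistemicBL.Carrier E → Set a) → IsFilter E F →
    (IsEpistemicFilter E F ⇔ Is∀Filter E F)
theorem4 E boolean F _ =
  mk⇔ (EpistemicProperties.epistemicFilter⇒∀Filter E)
      (BooleanEpistemicProperties.∀Filter⇒epistemicFilter E boolean)
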